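{- For every raw context $\Gamma$ of the theory Glob, if $\Gamma\vdash_{ps}$ then $\Gamma\vdash$ (in Glob).
   Context: Meta-theory: Martin-Löf type theory without axiom K. Raw syntax of Glob: raw types $*$ and $\Rightarrow(A,t,u)$; raw terms $\mathrm{Var}\,x$, $x\in\mathbb{N}$; raw contexts finite lists of pairs $(x,A)$ ($\mathrm{nil}$ empty, $L::p$ appends $p$, $\ell(L)$ length). Glob judgements $\Gamma\vdash$, $\Gamma\vdash A$, $\Gamma\vdash t:A$ are generated by: (ec) $\mathrm{nil}\vdash$; (cc) from $\Gamma\vdash$, $\Gamma\vdash A$, $x=\ell(\Gamma)$ derive $\Gamma::(x,A)\vdash$; (ob) from $\Gamma\vdash$ derive $\Gamma\vdash *$; (ar) from $\Gamma\vdash t:A$, $\Gamma\vdash u:A$ derive $\Gamma\vdash\Rightarrow(A,t,u)$; (var) from $\Gamma\vdash$ and $(x,A)\in\Gamma$ derive $\Gamma\vdash\mathrm{Var}\,x:A$. Ps-judgements: $\Gamma\vdash_{ps}x:A$ (for a raw context $\Gamma$, $x\in\mathbb{N}$, raw type $A$) is the inductive family generated by (pss) $\mathrm{nil}::(0,*)\vdash_{ps}0:*$; (psd) from $\Gamma\vdash_{ps}f:\Rightarrow(A,\mathrm{Var}\,x,\mathrm{Var}\,y)$ derive $\Gamma\vdash_{ps}y:A$; (pse) from $\Gamma\vdash_{ps}x:A$, with $l=\ell(\Gamma)$, derive $(\Gamma::(l,A))::(l+1,\Rightarrow(A,\mathrm{Var}\,x,\mathrm{Var}\,l))\vdash_{ps}l+1:\Rightarrow(A,\mathrm{Var}\,x,\mathrm{Var}\,l)$.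 Then $\Gamma\vdash_{ps}$ is generated by (ps): from $\Gamma\vdash_{ps}x:*$ derive $\Gamma\vdash_{ps}$. -}

module Defs where

open import Data.Nat using (ℕ; zero; suc; _+_)
open import Data.Product using (_×_; _,_)
open import Relation.Binary.PropositionalEquality using (_≡_)

data Tm : Set
data Ty : Set

data Tm where
  Var : ℕ → Tm

data Ty where
  ∗ : Ty
  ⇒ : Ty → Tm → Tm → Ty

data Ctx : Set where
  nil : Ctx
  _∷_ : Ctx → ℕ × Ty → Ctx

infixl 5 _∷_

ℓ : Ctx → ℕ
ℓ nil = 0
ℓ (Γ ∷ _) = suc (ℓ Γ)

data _∈_ : ℕ × Ty → Ctx → Set where
  here  : ∀ {Γ p} → p ∈ (Γ ∷ p)
  there : ∀ {Γ p q} → p ∈ Γ → p ∈ (Γ ∷ q)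

data _⊢ : Ctx → Set
data _⊢ty_ : Ctx → Ty → Set
data _⊢_∶_ : Ctx → Tm → Ty → Set

data _⊢ where
  ec : nil ⊢
  cc : ∀ {Γ A x} → Γ ⊢ → Γ ⊢ty A → x ≡ ℓ Γ → (Γ ∷ (x , A)) ⊢

data _⊢ty_ where
  ob : ∀ {Γ} → Γ ⊢ → Γ ⊢ty ∗
  ar : ∀ {Γ A t u} → Γ ⊢ t ∶ A → Γ ⊢ u ∶ A → Γ ⊢ty ⇒ A t u

data _⊢_∶_ where
  var : ∀ {Γ x A} → Γ ⊢ → (x , A) ∈ Γ → Γ ⊢ Var x ∶ A

data _⊢ps_∶_ : Ctx → ℕ → Ty → Set where
  pss : (nil ∷ (0 , ∗)) ⊢ps 0 ∶ ∗
  psd : ∀ {Γ f A x y} → Γ ⊢ps f ∶ ⇒ A (Var x) (Var y) → Γ ⊢ps y ∶ A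
  pse : ∀ {Γ x A} → Γ ⊢ps x ∶ A →
        ((Γ ∷ (ℓ Γ , A)) ∷ (suc (ℓ Γ) , ⇒ A (Var x) (Var (ℓ Γ))))
          ⊢ps suc (ℓ Γ) ∶ ⇒ A (Var x) (Var (ℓ Γ))

data _⊢ps : Ctx → Set where
  ps : ∀ {Γ x} → Γ ⊢ps x ∶ ∗ → Γ ⊢ps

-- Strengthen to: Γ ⊢ps x ∶ A implies Γ ⊢ Var x ∶ A (a derivation that carries Γ ⊢), by
-- induction on the ps-derivation. For psd the target Var y of an arrow must be typed; it is
-- read off the well-formed arrow type, using that the type of a typed term is well formed,
-- which in turn rests on weakening along context extension.
module Submission where

open import Defs
open import Data.Nat using (suc)
open import Data.Product using (_,_)
open import Relation.Binary.PropositionalEquality using (refl)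

weaken-tm : ∀ {Γ p t A} → (Γ ∷ p) ⊢ → Γ ⊢ t ∶ A → (Γ ∷ p) ⊢ t ∶ A
weaken-tm Γp⊢ (var _ x∈Γ) = var Γp⊢ (there x∈Γ)

weaken-ty : ∀ {Γ p A} → (Γ ∷ p) ⊢ → Γ ⊢ty A → (Γ ∷ p) ⊢ty A
weaken-ty Γp⊢ (ob _)   = ob Γp⊢
weaken-ty Γp⊢ (ar t u) = ar (weaken-tm Γp⊢ t) (weaken-tm Γp⊢ u)

∈⇒⊢ty : ∀ {Γ x A} → Γ ⊢ → (x , A) ∈ Γ → Γ ⊢ty A
∈⇒⊢ty Γp⊢@(cc _ ⊢A _) here         = weaken-ty Γp⊢ ⊢A
∈⇒⊢ty Γp⊢@(cc Γ⊢ _ _) (there x∈Γ) = weaken-ty Γp⊢ (∈⇒⊢ty Γ⊢ x∈Γ)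

⊢∶⇒⊢ty : ∀ {Γ t A} → Γ ⊢ t ∶ A → Γ ⊢ty A
⊢∶⇒⊢ty (var Γ⊢ x∈Γ) = ∈⇒⊢ty Γ⊢ x∈Γ

⊢∶⇒⊢ : ∀ {Γ t A} → Γ ⊢ t ∶ A → Γ ⊢
⊢∶⇒⊢ (var Γ⊢ _) = Γ⊢

⊢ps∶⇒⊢Var : ∀ {Γ x A} → Γ ⊢ps x ∶ A → Γ ⊢ Var x ∶ A
⊢ps∶⇒⊢Var pss = var ⋆⊢ here
  where
    ⋆⊢ : (nil ∷ (0 , ∗)) ⊢
    ⋆⊢ = cc ec (ob ec) refl
⊢ps∶⇒⊢Var (psd f) with ⊢∶⇒⊢ty (⊢ps∶⇒⊢Var f)
... | ar _ y = y
⊢ps∶⇒⊢Var (pse {Γ} {x} {A} d) = var ΓAf⊢ here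
  where
    x∶A : Γ ⊢ Var x ∶ A
    x∶A = ⊢ps∶⇒⊢Var d

    ΓA⊢ : (Γ ∷ (ℓ Γ , A)) ⊢
    ΓA⊢ = cc (⊢∶⇒⊢ x∶A) (⊢∶⇒⊢ty x∶A) refl

    ΓAf⊢ : (Γ ∷ (ℓ Γ , A) ∷ (suc (ℓ Γ) , ⇒ A (Var x) (Var (ℓ Γ)))) ⊢
    ΓAf⊢ = cc ΓA⊢ (ar (weaken-tm ΓA⊢ x∶A) (var ΓA⊢ here)) refl

mainTheorem14 : (Γ : Ctx) → Γ ⊢ps → Γ ⊢
mainTheorem14 Γ (ps d) = ⊢∶⇒⊢ (⊢ps∶⇒⊢Var d)
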